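{- Let $G$ be a connected graph with a vertex $r$ of eccentricity $2$. If $G$ has a Hamiltonian path, then $G$ is $r$-stackable.
   Context: The eccentricity of $r$ is $\max_v \mathrm{dist}_G(r,v)$. A configuration is a function $C:V(G)\to\mathbb{N}$ (numbers of cups). A cup stacking move from $u$ to $v$ is allowed when $C(u)\ge1$, $C(v)\ge1$ and $\mathrm{dist}_G(u,v)=C(u)$; it moves all cups of $u$ onto $v$. Let $\mathbf{1}$ be the configuration with one cup on every vertex. $G$ is $r$-stackable if some sequence of moves from $\mathbf{1}$ puts all cups on $r$. -}

module Defs where

open import Data.Nat using (ℕ; zero; suc; _+_; _≤_)
open import Data.Fin using (Fin; toℕ; _≟_)
open import Data.Product using (Σ; ∃; _×_; _,_)
open import Function.Definitions using (Injective)
open import Relation.Nullary using (¬_; yes; no)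
open import Relation.Binary.PropositionalEquality using (_≡_)
open import Relation.Binary.Construct.Closure.ReflexiveTransitive using (Star)

record Graph (n : ℕ) : Set₁ where
  field
    Adj   : Fin n → Fin n → Set
    sym   : ∀ {u v} → Adj u v → Adj v u
    irrefl : ∀ {u} → ¬ Adj u u
open Graph public

module _ {n : ℕ} (G : Graph n) where

  data Walk : Fin n → Fin n → ℕ → Set where
    here : ∀ {u} → Walk u u zero
    step : ∀ {u w v k} → Adj G u w → Walk w v k → Walk u v (suc k)

  Dist : Fin n → Fin n → ℕ → Set
  Dist u v d = Walk u v d × (∀ {m} → Walk u v m → d ≤ m)

  Connected : Set
  Connected = ∀ u v → ∃ λ k → Walk u v k

  Eccentricity≡ : Fin n → ℕ → Set
  Eccentricity≡ r e =
    (∀ v → ∃ λ d → Dist r v d × d ≤ e) × (∃ λ v → Dist r v e)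

  -- Hamiltonian path: an ordering σ of all vertices (injective, hence
  -- bijective on Fin n) with consecutive vertices adjacent.
  HamiltonianPath : Set
  HamiltonianPath = Σ (Fin n → Fin n) λ σ →
    Injective _≡_ _≡_ σ ×
    (∀ (i j : Fin n) → toℕ j ≡ suc (toℕ i) → Adj G (σ i) (σ j))

  Config : Set
  Config = Fin n → ℕ

  moveCups : Config → Fin n → Fin n → Config
  moveCups C u v w with w ≟ u | w ≟ v
  ... | yes _ | _     = 0
  ... | no _  | yes _ = C v + C u
  ... | no _  | no _  = C w

  data Move : Config → Config → Set where
    move : ∀ {C} u v → 1 ≤ C u → 1 ≤ C v → Dist u v (C u) →
           Move C (moveCups C u v)

  one : Config
  one _ = 1

  AllOn : Fin n → Config → Set
  AllOn r C = C r ≡ n × (∀ w → ¬ w ≡ r → C w ≡ 0)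

  Stackable : Fin n → Set
  Stackable r = ∃ λ C → Star Move one C × AllOn r C

-- Cut the Hamiltonian path at r. On either side, group the vertices from the
-- end far from r into adjacent pairs, leaving at most one unpaired vertex,
-- which is then the neighbour of r on the path. An unpaired vertex, like any
-- vertex adjacent to r, sends its cup to r. For a pair {a, b}, eccentricity 2
-- puts both at distance 1 or 2 from r: if, say, b is at distance 2, stack a
-- onto b and then the two cups of b onto r; otherwise send both to r directly.
module Submission where

open import Defs hiding (sym)
open import Data.Nat using (ℕ; zero; suc; _+_; _≤_; z≤n; s≤s)
open import Data.Nat.Properties using (+-assoc; +-identityʳ; m≤m+n; ≤-trans; ≤-refl; <-irrefl)
open import Data.Fin as Fin using (Fin; toℕ; _≟_; punchOut)
open import Data.Fin.Properties using (any?; punchOut-injective; injective⇒≤)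
open import Data.Product using (∃; ∃₂; _×_; _,_; proj₁)
open import Data.Sum using (_⊎_; inj₁; inj₂)
open import Data.Empty using (⊥-elim)
open import Data.List using (List; []; _∷_; _++_; [_]; length; tabulate; drop)
open import Data.List.Properties using (length-++; length-tabulate; ++-identityʳ)
open import Data.List.Relation.Unary.All as All using (All; []; _∷_)
open import Data.List.Relation.Unary.All.Properties using (++⁻ʳ)
open import Data.List.Relation.Unary.Any using (here; there)
open import Data.List.Relation.Unary.AllPairs using (_∷_)
open import Data.List.Relation.Unary.Unique.Propositional using (Unique)
open import Data.List.Relation.Unary.Unique.Propositional.Properties using (tabulate⁺)
open import Data.List.Relation.Unary.Linked as Linked using (Linked; []; [-]; _∷_)
open import Data.List.Relation.Binary.Permutation.Propositional using (_↭_; ↭-refl; ↭-sym; ↭-prep; ↭-swap; ↭⇒↭ₛ)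
open import Data.List.Relation.Binary.Permutation.Propositional.Properties using (∈-resp-↭; ↭-length; shift)
open import Data.List.Relation.Binary.Permutation.Setoid.Properties using (Unique-resp-↭)
open import Data.List.Membership.Propositional using (_∈_; _∉_)
open import Data.List.Membership.Propositional.Properties using (∈-tabulate⁺; ∈-∃++; ∈-++⁻; ∈-++⁺ʳ)
open import Function.Base using (_∘_)
open import Function.Definitions using (Injective)
open import Relation.Nullary using (yes; no)
open import Relation.Binary.PropositionalEquality
  using (_≡_; _≢_; refl; sym; trans; cong; cong₂; subst; setoid; module ≡-Reasoning)
open import Relation.Binary.Construct.Closure.ReflexiveTransitive using (Star; ε; _◅_; _◅◅_)

injective⇒surjective : ∀ {n} {σ : Fin n → Fin n} → Injective _≡_ _≡_ σ → ∀ w → ∃ λ i → σ i ≡ w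
injective⇒surjective {zero} _ ()
injective⇒surjective {suc m} {σ} σ-inj w with any? (λ i → σ i ≟ w)
... | yes hit = hit
... | no miss = ⊥-elim (<-irrefl refl (injective⇒≤ punchOut-inj))
  where
  σ≢w : ∀ i → w ≢ σ i
  σ≢w i w≡σi = miss (i , sym w≡σi)
  punchOut-inj : Injective _≡_ _≡_ (λ i → punchOut (σ≢w i))
  punchOut-inj {i} {j} eq = σ-inj (punchOut-injective (σ≢w i) (σ≢w j) eq)

module _ {A : Set} where

  Unique-++⁻ʳ : ∀ xs {ys : List A} → Unique (xs ++ ys) → Unique ys
  Unique-++⁻ʳ []       u       = u
  Unique-++⁻ʳ (_ ∷ xs) (_ ∷ u) = Unique-++⁻ʳ xs u

  Unique-++⇒∉ : ∀ xs {ys : List A} {w} → Unique (xs ++ ys) → w ∈ ys → w ∉ xs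
  Unique-++⇒∉ (_ ∷ xs) (x≢ ∷ _) w∈ys (here w≡x) = All.lookup (++⁻ʳ xs x≢) w∈ys (sym w≡x)
  Unique-++⇒∉ (_ ∷ xs) (_ ∷ u)  w∈ys (there w∈xs) = Unique-++⇒∉ xs u w∈ys w∈xs

  Linked-tabulate : ∀ {R : A → A → Set} {m} (f : Fin m → A) →
                    (∀ i j → toℕ j ≡ suc (toℕ i) → R (f i) (f j)) → Linked R (tabulate f)
  Linked-tabulate {m = zero}        f next = []
  Linked-tabulate {m = suc zero}    f next = [-]
  Linked-tabulate {m = suc (suc m)} f next =
    next Fin.zero (Fin.suc Fin.zero) refl ∷
    Linked-tabulate (λ i → f (Fin.suc i)) (λ i j eq → next (Fin.suc i) (Fin.suc j) (cong suc eq))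

module _ {n : ℕ} (G : Graph n) where

  Walk-snoc : ∀ {u v w k} → Walk G u v k → Adj G v w → Walk G u w (suc k)
  Walk-snoc here       v~w = step v~w here
  Walk-snoc (step a p) v~w = step a (Walk-snoc p v~w)

  Walk-reverse : ∀ {u v k} → Walk G u v k → Walk G v u k
  Walk-reverse here       = here
  Walk-reverse (step a p) = Walk-snoc (Walk-reverse p) (Graph.sym G a)

  Dist-sym : ∀ {u v d} → Dist G u v d → Dist G v u d
  Dist-sym (p , shortest) = Walk-reverse p , λ q → shortest (Walk-reverse q)

  Adj⇒Dist₁ : ∀ {u v} → Adj G u v → Dist G u v 1
  Adj⇒Dist₁ {u} {v} u~v = step u~v here , nonempty
    where
    nonempty : ∀ {m} → Walk G u v m → 1 ≤ m
    nonempty here       = ⊥-elim (irrefl G u~v)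
    nonempty (step _ _) = s≤s z≤n

  moveCups-source : ∀ C u v → moveCups G C u v u ≡ 0
  moveCups-source C u v with u ≟ u
  ... | yes _   = refl
  ... | no u≢u = ⊥-elim (u≢u refl)

  moveCups-target : ∀ C {u v} → u ≢ v → moveCups G C u v v ≡ C v + C u
  moveCups-target C {u} {v} u≢v with v ≟ u | v ≟ v
  ... | yes v≡u | _       = ⊥-elim (u≢v (sym v≡u))
  ... | no _    | yes _   = refl
  ... | no _    | no v≢v = ⊥-elim (v≢v refl)

  moveCups-other : ∀ C {u v w} → w ≢ u → w ≢ v → moveCups G C u v w ≡ C w
  moveCups-other C {u} {v} {w} w≢u w≢v with w ≟ u | w ≟ v
  ... | yes w≡u | _       = ⊥-elim (w≢u w≡u)
  ... | no _    | yes w≡v = ⊥-elim (w≢v w≡v)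
  ... | no _    | no _    = refl

  legal-move : ∀ {C u v k} → C u ≡ suc k → 1 ≤ C v → Dist G u v (suc k) → Move G C (moveCups G C u v)
  legal-move {u = u} {v} Cu≡ Cv≥1 d =
    move u v (subst (1 ≤_) (sym Cu≡) (s≤s z≤n)) Cv≥1 (subst (Dist G u v) (sym Cu≡) d)

module Stacking {n : ℕ} (G : Graph n) (r : Fin n) where

  open import Data.List.Membership.DecPropositional (_≟_ {n}) using (_∈?_)

  record Remaining (C : Config G) (L : List (Fin n)) : Set where
    field
      total    : C r + length L ≡ n
      root-pos : 1 ≤ C r
      distinct : Unique (r ∷ L)
      listed   : ∀ {w} → w ∈ L → C w ≡ 1
      unlisted : ∀ {w} → w ∉ r ∷ L → C w ≡ 0

    listed≢root : ∀ {w} → w ∈ L → w ≢ r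
    listed≢root w∈L w≡r with distinct
    ... | r≢ ∷ _ = All.lookup r≢ w∈L (sym w≡r)
  open Remaining

  Reach : Config G → List (Fin n) → Set
  Reach C L = ∃ λ D → Star (Move G) C D × Remaining D L

  _>>=_ : ∀ {C L L′} → Reach C L → (∀ {D} → Remaining D L → Reach D L′) → Reach C L′
  (D , C⟶D , R) >>= k with E , D⟶E , R′ ← k R = E , C⟶D ◅◅ D⟶E , R′

  Remaining-resp-↭ : ∀ {C L L′} → L ↭ L′ → Remaining C L → Remaining C L′
  Remaining-resp-↭ {C} L↭L′ R = record
    { total    = trans (cong (C r +_) (sym (↭-length L↭L′))) (total R)
    ; root-pos = root-pos R
    ; distinct = Unique-resp-↭ (setoid (Fin n)) (↭⇒↭ₛ (↭-prep r L↭L′)) (distinct R)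
    ; listed   = λ w∈L′ → listed R (∈-resp-↭ (↭-sym L↭L′) w∈L′)
    ; unlisted = λ w∉L′ → unlisted R (λ w∈L → w∉L′ (∈-resp-↭ (↭-prep r L↭L′) w∈L))
    }

  Remaining-drop : ∀ {C C′} xs {L} → Remaining C (xs ++ L) →
                   C′ r ≡ C r + length xs → (∀ {w} → w ≢ r → w ∉ xs → C′ w ≡ C w) →
                   All (λ w → C′ w ≡ 0) xs → Remaining C′ L
  Remaining-drop {C} {C′} xs {L} R C′r≡ frame emptied = record
    { total    = total′
    ; root-pos = subst (1 ≤_) (sym C′r≡) (≤-trans (root-pos R) (m≤m+n (C r) (length xs)))
    ; distinct = distinct′ (distinct R)
    ; listed   = λ w∈L → trans (frame (listed≢root R (∈-++⁺ʳ xs w∈L))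
                                      (Unique-++⇒∉ (r ∷ xs) (distinct R) w∈L ∘ there))
                                (listed R (∈-++⁺ʳ xs w∈L))
    ; unlisted = unlisted′
    }
    where
    open ≡-Reasoning
    total′ : C′ r + length L ≡ n
    total′ = begin
      C′ r + length L                ≡⟨ cong (_+ length L) C′r≡ ⟩
      C r + length xs + length L     ≡⟨ +-assoc (C r) (length xs) (length L) ⟩
      C r + (length xs + length L)   ≡⟨ cong (C r +_) (sym (length-++ xs)) ⟩
      C r + length (xs ++ L)         ≡⟨ total R ⟩
      n                              ∎
    distinct′ : Unique (r ∷ xs ++ L) → Unique (r ∷ L)
    distinct′ (r≢ ∷ u) = ++⁻ʳ xs r≢ ∷ Unique-++⁻ʳ xs u
    unlisted′ : ∀ {w} → w ∉ r ∷ L → C′ w ≡ 0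
    unlisted′ {w} w∉r∷L with w ∈? xs
    ... | yes w∈xs = All.lookup emptied w∈xs
    ... | no  w∉xs = trans (frame (w∉r∷L ∘ here) w∉xs) (unlisted R w∉r∷xs++L)
      where
      w∉r∷xs++L : w ∉ r ∷ xs ++ L
      w∉r∷xs++L (here w≡r) = w∉r∷L (here w≡r)
      w∉r∷xs++L (there w∈) with ∈-++⁻ xs w∈
      ... | inj₁ w∈xs = w∉xs w∈xs
      ... | inj₂ w∈L  = w∉r∷L (there w∈L)

  send-to-root : ∀ {C x L} → Remaining C (x ∷ L) → Adj G x r → Reach C L
  send-to-root {C} {x} R x~r =
    C′ , legal-move G Cx≡1 (root-pos R) (Adj⇒Dist₁ G x~r) ◅ ε ,
    Remaining-drop [ x ] R C′r≡ frame (moveCups-source G C x r ∷ [])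
    where
    C′ = moveCups G C x r
    Cx≡1 : C x ≡ 1
    Cx≡1 = listed R (here refl)
    C′r≡ : C′ r ≡ C r + 1
    C′r≡ = trans (moveCups-target G C (listed≢root R (here refl))) (cong (C r +_) Cx≡1)
    frame : ∀ {w} → w ≢ r → w ∉ [ x ] → C′ w ≡ C w
    frame w≢r w∉ = moveCups-other G C (w∉ ∘ here) w≢r

  merge-and-send : ∀ {C a b L} → Remaining C (a ∷ b ∷ L) → Adj G a b → Dist G b r 2 → Reach C L
  merge-and-send {C} {a} {b} R a~b b↝r =
    C₂ , legal-move G Ca≡1 (subst (1 ≤_) (sym Cb≡1) ≤-refl) (Adj⇒Dist₁ G a~b) ◅
         legal-move G C₁b≡2 C₁r≥1 b↝r ◅ ε ,
    Remaining-drop (a ∷ b ∷ []) R C₂r≡ frame (C₂a≡0 ∷ moveCups-source G C₁ b r ∷ [])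
    where
    C₁ = moveCups G C a b
    C₂ = moveCups G C₁ b r
    a≢r : a ≢ r
    a≢r = listed≢root R (here refl)
    b≢r : b ≢ r
    b≢r = listed≢root R (there (here refl))
    a≢b : a ≢ b
    a≢b with distinct R
    ... | _ ∷ (a≢ ∷ _) ∷ _ = a≢
    Ca≡1 : C a ≡ 1
    Ca≡1 = listed R (here refl)
    Cb≡1 : C b ≡ 1
    Cb≡1 = listed R (there (here refl))
    C₁b≡2 : C₁ b ≡ 2
    C₁b≡2 = trans (moveCups-target G C a≢b) (cong₂ _+_ Cb≡1 Ca≡1)
    C₁r≡ : C₁ r ≡ C r
    C₁r≡ = moveCups-other G C (λ r≡a → a≢r (sym r≡a)) (λ r≡b → b≢r (sym r≡b))
    C₁r≥1 : 1 ≤ C₁ r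
    C₁r≥1 = subst (1 ≤_) (sym C₁r≡) (root-pos R)
    C₂r≡ : C₂ r ≡ C r + 2
    C₂r≡ = trans (moveCups-target G C₁ b≢r) (cong₂ _+_ C₁r≡ C₁b≡2)
    C₂a≡0 : C₂ a ≡ 0
    C₂a≡0 = trans (moveCups-other G C₁ a≢b a≢r) (moveCups-source G C a b)
    frame : ∀ {w} → w ≢ r → w ∉ a ∷ b ∷ [] → C₂ w ≡ C w
    frame w≢r w∉ = trans (moveCups-other G C₁ (w∉ ∘ there ∘ here) w≢r)
                         (moveCups-other G C (w∉ ∘ here) (w∉ ∘ there ∘ here))

  near-root : Eccentricity≡ G r 2 → ∀ {v} → v ≢ r → Adj G v r ⊎ Dist G v r 2
  near-root (bounded , _) {v} v≢r with bounded v
  ... | zero , (here , _) , _                 = ⊥-elim (v≢r refl)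
  ... | suc zero , (step r~v here , _) , _    = inj₁ (Graph.sym G r~v)
  ... | suc (suc zero) , r↝v , _              = inj₂ (Dist-sym G r↝v)
  ... | suc (suc (suc _)) , _ , s≤s (s≤s ())

  clear-pair : Eccentricity≡ G r 2 → ∀ {C a b L} → Remaining C (a ∷ b ∷ L) → Adj G a b → Reach C L
  clear-pair ecc R a~b
    with near-root ecc (listed≢root R (there (here refl))) | near-root ecc (listed≢root R (here refl))
  ... | inj₂ b↝r | _        = merge-and-send R a~b b↝r
  ... | inj₁ _   | inj₂ a↝r =
    merge-and-send (Remaining-resp-↭ (↭-swap _ _ ↭-refl) R) (Graph.sym G a~b) a↝r
  ... | inj₁ b~r | inj₁ a~r = send-to-root R a~r >>= λ R′ → send-to-root R′ b~r

  data Tiled : List (Fin n) → Set where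
    []     : Tiled []
    single : ∀ {x L} → Adj G x r → Tiled L → Tiled (x ∷ L)
    pair   : ∀ {a b L} → Adj G a b → Tiled L → Tiled (a ∷ b ∷ L)

  clear : Eccentricity≡ G r 2 → ∀ {C L L′} → Tiled L → Remaining C (L ++ L′) → Reach C L′
  clear ecc []               R = _ , ε , R
  clear ecc (single x~r t)   R = send-to-root R x~r >>= clear ecc t
  clear ecc (pair a~b t)     R = clear-pair ecc R a~b >>= clear ecc t

  tiled-before : ∀ L {R} → Linked (Adj G) (L ++ r ∷ R) → Tiled L × Tiled (drop 1 L)
  tiled-before []          _           = [] , []
  tiled-before (_ ∷ [])    (x~r ∷ _)   = single x~r [] , []
  tiled-before (_ ∷ y ∷ L) (x~y ∷ lnk) with tiled-before (y ∷ L) lnk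
  ... | t , t′ = pair x~y t′ , t

  tiled-or-tail-tiled : ∀ x L → Linked (Adj G) (x ∷ L) → Tiled (x ∷ L) ⊎ Tiled L
  tiled-or-tail-tiled x []      _           = inj₂ []
  tiled-or-tail-tiled x (y ∷ L) (x~y ∷ lnk) with tiled-or-tail-tiled y L lnk
  ... | inj₁ t = inj₂ t
  ... | inj₂ t = inj₁ (pair x~y t)

  tiled-after : ∀ L {R} → Linked (Adj G) (L ++ r ∷ R) → Tiled R
  tiled-after (_ ∷ L)  lnk = tiled-after L (Linked.tail lnk)
  tiled-after [] {R} lnk with tiled-or-tail-tiled r R lnk
  ... | inj₂ t               = t
  ... | inj₁ (single r~r _) = ⊥-elim (irrefl G r~r)
  ... | inj₁ (pair r~y t)   = single (Graph.sym G r~y) t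

  Remaining-one : ∀ {L} → Unique (r ∷ L) → (∀ w → w ∈ r ∷ L) → length (r ∷ L) ≡ n →
                  Remaining (one G) L
  Remaining-one distinct covers size = record
    { total    = size
    ; root-pos = ≤-refl
    ; distinct = distinct
    ; listed   = λ _ → refl
    ; unlisted = λ {w} w∉ → ⊥-elim (w∉ (covers w))
    }

  hamiltonian-split : HamiltonianPath G →
                      ∃₂ λ L R → Linked (Adj G) (L ++ r ∷ R) × Remaining (one G) (L ++ R)
  hamiltonian-split (σ , σ-inj , σ-adj) = split (∈-∃++ (on-path r))
    where
    path = tabulate σ
    on-path : ∀ w → w ∈ path
    on-path w with i , σi≡w ← injective⇒surjective σ-inj w = subst (_∈ path) σi≡w (∈-tabulate⁺ i)
    split : (∃₂ λ L R → path ≡ L ++ r ∷ R) →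
            ∃₂ λ L R → Linked (Adj G) (L ++ r ∷ R) × Remaining (one G) (L ++ R)
    split (L , R , path≡) = L , R , subst (Linked (Adj G)) path≡ (Linked-tabulate σ σ-adj) ,
      Remaining-one (Unique-resp-↭ (setoid (Fin n)) (↭⇒↭ₛ shifted) (tabulate⁺ σ-inj))
                    (λ w → ∈-resp-↭ shifted (on-path w))
                    (trans (sym (↭-length shifted)) (length-tabulate σ))
      where
      shifted : path ↭ r ∷ L ++ R
      shifted = subst (_↭ r ∷ L ++ R) (sym path≡) (shift r L R)

  Remaining-[]⇒AllOn : ∀ {C} → Remaining C [] → AllOn G r C
  Remaining-[]⇒AllOn {C} R =
    trans (sym (+-identityʳ (C r))) (total R) ,
    λ w w≢r → unlisted R λ { (here w≡r) → w≢r w≡r }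

  stackable : Eccentricity≡ G r 2 → HamiltonianPath G → Stackable G r
  stackable ecc ham with L , R , lnk , R₀ ← hamiltonian-split ham
    with C , moves , done ← (clear ecc (proj₁ (tiled-before L lnk)) R₀ >>= λ R′ →
                             clear ecc (tiled-after L lnk) (subst (Remaining _) (sym (++-identityʳ R)) R′))
    = C , moves , Remaining-[]⇒AllOn done

corollary14 : (n : ℕ) (G : Graph n) (r : Fin n) →
    Connected G → Eccentricity≡ G r 2 → HamiltonianPath G →
    Stackable G r
corollary14 n G r _ = Stacking.stackable G r
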